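{- For $m\ge3$ and $n\geq 2$, the zero-free chromatic polynomial of $B_m^n$ is $\chi^b_{B_m^n}(\lambda)=\lambda(\lambda-2)\gamma_m^n$, where $\gamma_m=\frac{(\lambda-1)^{m-1}-(-1)^{m-1}}{\lambda}$.
   Context: The book graph $B(m,n)$ has vertices $\{u,v\}\cup\{u_j^i:1\le i\le n,1\le j\le m-2\}$ and consists of the $n$ cycles $uu_1^i\cdots u_{m-2}^ivu$ sharing the edge $uv$. $B_m^n$ is obtained from $B(m,n)$ by replacing $uv$ with two parallel edges between $u$ and $v$, one positive and one negative, all other edges positive. A zero-free coloring in $2k$ signed colors is a map $c:V\to\{ -k,\ldots,-1,1,\ldots,k\}$, proper if $c(x)\ne\sigma(e)c(y)$ for every edge $e=xy$; the zero-free chromatic polynomial is the polynomial whose value at $\lambda=2k$ counts proper zero-free colorings. -}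

module Defs where

open import Data.Nat as ℕ using (ℕ; zero; suc)
open import Data.Integer as ℤ using (ℤ; +_; -_; _-_; _*_; _^_; -1ℤ; 1ℤ)
open import Data.Integer.DivMod using (_/_)
open import Data.Fin as Fin using (Fin; zero; suc; combine; _↑ʳ_; inject₁; fromℕ; toℕ)
open import Data.List as List using (List; []; _∷_; _++_; concatMap; map; filter; length; allFin)
open import Data.List.Relation.Unary.All using (All; all?)
open import Data.Vec as Vec using (Vec; []; _∷_; lookup)
open import Data.Sign as Sign using (Sign)
open import Data.Product using (_×_; _,_)
open import Relation.Binary.PropositionalEquality using (_≢_)
open import Relation.Nullary.Decidable using (¬?; Dec)

-- Signed multigraphs on the vertex set Fin N.
-- An edge is (x , y , σ) with σ its sign; parallel edges are allowed.

Edge : ℕ → Set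
Edge N = Fin N × Fin N × Sign

record SignedGraph : Set where
  field
    nV    : ℕ
    edges : List (Edge nV)
open SignedGraph public

-- Zero-free signed colours with 2k colours: {-k,…,-1,1,…,k}.
-- A colour is (s , a) with value s·(a+1), a : Fin k.

Colour : ℕ → Set
Colour k = Sign × Fin k

colourVal : ∀ {k} → Colour k → ℤ
colourVal (s , a) = s ℤ.◃ suc (toℕ a)

allColours : (k : ℕ) → List (Colour k)
allColours k = concatMap (λ s → map (λ a → (s , a)) (allFin k)) (Sign.+ ∷ Sign.- ∷ [])

signAct : Sign → ℤ → ℤ
signAct Sign.+ z = z
signAct Sign.- z = - z

allVecs : ∀ {A : Set} (N : ℕ) → List A → List (Vec A N)
allVecs zero    xs = [] ∷ []
allVecs (suc N) xs = concatMap (λ x → map (x ∷_) (allVecs N xs)) xs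

ProperEdge : ∀ {N k} → Vec (Colour k) N → Edge N → Set
ProperEdge c (x , y , σ) = colourVal (lookup c x) ≢ signAct σ (colourVal (lookup c y))

Proper : ∀ {k} (G : SignedGraph) → Vec (Colour k) (nV G) → Set
Proper G c = All (ProperEdge c) (edges G)

proper? : ∀ {k} (G : SignedGraph) (c : Vec (Colour k) (nV G)) → Dec (Proper G c)
proper? G c = all? (λ { (x , y , σ) → ¬? (colourVal (lookup c x) ℤ.≟ signAct σ (colourVal (lookup c y))) }) (edges G)

zeroFreeCount : SignedGraph → ℕ → ℕ
zeroFreeCount G k = length (filter (proper? G) (allVecs (nV G) (allColours k)))

-- The book graph B_m^n.
-- Vertices: u = 0, v = 1, and u_j^i (i : Fin n, j : Fin (m-2), 0-based)
-- is 2 + (i·(m-2) + j).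

bookN : ℕ → ℕ → ℕ
bookN m n = 2 ℕ.+ n ℕ.* (m ℕ.∸ 2)

module _ (m n : ℕ) where
  private
    d = m ℕ.∸ 2
    N = bookN m n

  bu : Fin N
  bu = zero

  bv : Fin N
  bv = suc zero

  bx : Fin n → Fin d → Fin N
  bx i j = 2 ↑ʳ combine i j

  prevGen : ∀ {d'} → (Fin d' → Fin N) → Fin d' → Fin N
  prevGen x zero    = bu
  prevGen x (suc j) = x (inject₁ j)

  prev : Fin n → Fin d → Fin N
  prev i = prevGen (bx i)

  lastEdge : (d' : ℕ) → (Fin d' → Fin N) → List (Edge N)
  lastEdge zero     x = []
  lastEdge (suc d') x = (x (fromℕ d') , bv , Sign.+) ∷ []

  pageEdges : Fin n → List (Edge N)
  pageEdges i = map (λ j → (prev i j , bx i j , Sign.+)) (allFin d) ++ lastEdge d (bx i)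

  -- B_m^n : the n cycles u u_1^i … u_{m-2}^i v u, with the shared edge uv
  -- replaced by a positive and a negative parallel edge; all other edges positive.
  bookSigned : SignedGraph
  bookSigned = record
    { nV    = N
    ; edges = (bu , bv , Sign.+) ∷ (bu , bv , Sign.-) ∷ concatMap pageEdges (allFin n)
    }

-- λ = 2k with k = suc k' ≥ 1, and γ_m = ((λ-1)^{m-1} - (-1)^{m-1}) / λ
-- (exact integer division; λ ≠ 0).

lam : ℕ → ℤ
lam k' = + (2 ℕ.* suc k')

gamma : ℕ → ℕ → ℤ
gamma m k' = ((lam k' - 1ℤ) ^ (m ℕ.∸ 1) - (-1ℤ ^ (m ℕ.∸ 1))) / lam k'

module Submission where

-- A colouring of B_m^n is proper iff the colours a, b of u, v satisfy a ≠ b and a ≠ −b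
-- (the two parallel edges) and, on every page independently, the inner vertices
-- u_1 … u_{m-2} form a walk a → u_1 → … → b of length m − 1 with consecutive colours
-- distinct (all page edges are positive).  Walks of length d + 1 between distinct
-- vertices of the complete graph K_λ satisfy W_{d+1} + W_d = (λ − 1)^{d+1}, whence
-- λ W_{m-2} = (λ − 1)^{m-1} − (−1)^{m-1}, i.e. W = γ_m.  Since no colour is 0, a ≠ −a, so
-- each a has exactly λ − 2 admissible partners b, and the count is λ (λ − 2) γ_m^n.

open import Defs
open import Data.Bool using (if_then_else_)
open import Data.Empty using (⊥-elim)
open import Data.Fin using (Fin; zero; suc; combine; inject₁; fromℕ)
import Data.Fin.Properties as Finₚ
open import Data.Integer as ℤ using (ℤ; +_; -_; _*_; _-_; _^_; -1ℤ; 1ℤ)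
open import Data.Integer.DivMod using (_/_; div-pos-is-/ℕ)
import Data.Integer.Properties as ℤₚ
open import Data.Integer.Tactic.RingSolver using (solve-∀)
open import Data.List using (List; []; _∷_; _++_; map; concatMap; filter; length; allFin)
import Data.List.Properties as Listₚ
open import Data.List.Membership.Propositional using (_∈_)
open import Data.List.Membership.Propositional.Properties using (∈-allFin; ∈-cartesianProduct⁺)
open import Data.List.Relation.Unary.All as All using (All; all?; []; _∷_)
open import Data.List.Relation.Unary.Any using (here; there)
open import Data.List.Relation.Unary.Unique.Propositional using (Unique; []; _∷_)
import Data.List.Relation.Unary.Unique.Propositional.Properties as Uniqueₚ
open import Data.Nat as ℕ using (ℕ; zero; suc; _≤_; s≤s)
open import Data.Nat.DivMod using (m*n/n≡m)
import Data.Nat.Properties as ℕₚ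
open import Algebra.Properties.CommutativeSemigroup ℕₚ.+-commutativeSemigroup using (interchange)
open import Data.Product using (_,_)
open import Data.Sign as Sign using (Sign)
open import Data.Vec as Vec using (Vec; []; _∷_; lookup)
import Data.Vec.Properties as Vecₚ
open import Function using (_∘_; id)
open import Relation.Binary.Definitions using (DecidableEquality)
open import Relation.Binary.PropositionalEquality
open import Relation.Nullary using (Dec; yes; no; does; ¬_; ¬?; _×-dec_)
open import Relation.Nullary.Decidable using (map′)
open import Relation.Unary using (Pred; Decidable)
open ≡-Reasoning

variable
  A B : Set
  P Q : Set

𝟙 : Dec P → ℕ
𝟙 p = if does p then 1 else 0

𝟙-yes : (p : Dec P) → P → 𝟙 p ≡ 1
𝟙-yes (yes _) _ = refl
𝟙-yes (no ¬p) p = ⊥-elim (¬p p)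

𝟙-no : (p : Dec P) → ¬ P → 𝟙 p ≡ 0
𝟙-no (yes p) ¬p = ⊥-elim (¬p p)
𝟙-no (no _)  _  = refl

𝟙-⇔ : (p : Dec P) (q : Dec Q) → (P → Q) → (Q → P) → 𝟙 p ≡ 𝟙 q
𝟙-⇔ (yes _)  (yes _)  _ _ = refl
𝟙-⇔ (no _)   (no _)   _ _ = refl
𝟙-⇔ (yes p)  (no ¬q)  f _ = ⊥-elim (¬q (f p))
𝟙-⇔ (no ¬p)  (yes q)  _ g = ⊥-elim (¬p (g q))

𝟙-×-dec : (p : Dec P) (q : Dec Q) → 𝟙 (p ×-dec q) ≡ 𝟙 p ℕ.* 𝟙 q
𝟙-×-dec (yes _) q = sym (ℕₚ.*-identityˡ (𝟙 q))
𝟙-×-dec (no _)  q = refl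

∑ : List A → (A → ℕ) → ℕ
∑ []       f = 0
∑ (x ∷ xs) f = f x ℕ.+ ∑ xs f

∏ : List A → (A → ℕ) → ℕ
∏ []       f = 1
∏ (x ∷ xs) f = f x ℕ.* ∏ xs f

syntax ∑ xs (λ x → e) = ∑[ x ∈ xs ] e
syntax ∏ xs (λ x → e) = ∏[ x ∈ xs ] e

module _ {f g : A → ℕ} where

  ∑-cong : (∀ x → f x ≡ g x) → ∀ xs → ∑ xs f ≡ ∑ xs g
  ∑-cong f≗g []       = refl
  ∑-cong f≗g (x ∷ xs) = cong₂ ℕ._+_ (f≗g x) (∑-cong f≗g xs)

  ∏-cong : (∀ x → f x ≡ g x) → ∀ xs → ∏ xs f ≡ ∏ xs g
  ∏-cong f≗g []       = refl
  ∏-cong f≗g (x ∷ xs) = cong₂ ℕ._*_ (f≗g x) (∏-cong f≗g xs)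

  ∑-+ : ∀ xs → ∑[ x ∈ xs ] (f x ℕ.+ g x) ≡ ∑ xs f ℕ.+ ∑ xs g
  ∑-+ []       = refl
  ∑-+ (x ∷ xs) = trans (cong (f x ℕ.+ g x ℕ.+_) (∑-+ xs)) (interchange (f x) (g x) (∑ xs f) (∑ xs g))

module _ (f : A → ℕ) where

  ∑-++ : ∀ xs ys → ∑ (xs ++ ys) f ≡ ∑ xs f ℕ.+ ∑ ys f
  ∑-++ []       ys = refl
  ∑-++ (x ∷ xs) ys = trans (cong (f x ℕ.+_) (∑-++ xs ys)) (sym (ℕₚ.+-assoc (f x) _ _))

  ∏-++ : ∀ xs ys → ∏ (xs ++ ys) f ≡ ∏ xs f ℕ.* ∏ ys f
  ∏-++ []       ys = sym (ℕₚ.+-identityʳ (∏ ys f))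
  ∏-++ (x ∷ xs) ys = trans (cong (f x ℕ.*_) (∏-++ xs ys)) (sym (ℕₚ.*-assoc (f x) _ _))

  ∑-*ˡ : ∀ c xs → ∑[ x ∈ xs ] (c ℕ.* f x) ≡ c ℕ.* ∑ xs f
  ∑-*ˡ c []       = sym (ℕₚ.*-zeroʳ c)
  ∑-*ˡ c (x ∷ xs) = trans (cong (c ℕ.* f x ℕ.+_) (∑-*ˡ c xs)) (sym (ℕₚ.*-distribˡ-+ c (f x) _))

  ∑-*ʳ : ∀ c xs → ∑[ x ∈ xs ] (f x ℕ.* c) ≡ ∑ xs f ℕ.* c
  ∑-*ʳ c xs = begin
    ∑[ x ∈ xs ] (f x ℕ.* c) ≡⟨ ∑-cong (λ x → ℕₚ.*-comm (f x) c) xs ⟩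
    ∑[ x ∈ xs ] (c ℕ.* f x) ≡⟨ ∑-*ˡ c xs ⟩
    c ℕ.* ∑ xs f            ≡⟨ ℕₚ.*-comm c _ ⟩
    ∑ xs f ℕ.* c            ∎

∑-const : ∀ c (xs : List A) → ∑[ x ∈ xs ] c ≡ length xs ℕ.* c
∑-const c []       = refl
∑-const c (x ∷ xs) = cong (c ℕ.+_) (∑-const c xs)

module _ (f : B → ℕ) (h : A → B) where

  ∑-map : ∀ xs → ∑ (map h xs) f ≡ ∑ xs (f ∘ h)
  ∑-map []       = refl
  ∑-map (x ∷ xs) = cong (f (h x) ℕ.+_) (∑-map xs)

  ∏-map : ∀ xs → ∏ (map h xs) f ≡ ∏ xs (f ∘ h)
  ∏-map []       = refl
  ∏-map (x ∷ xs) = cong (f (h x) ℕ.*_) (∏-map xs)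

module _ (f : B → ℕ) (h : A → List B) where

  ∑-concatMap : ∀ xs → ∑ (concatMap h xs) f ≡ ∑[ x ∈ xs ] ∑ (h x) f
  ∑-concatMap []       = refl
  ∑-concatMap (x ∷ xs) = trans (∑-++ f (h x) (concatMap h xs)) (cong (∑ (h x) f ℕ.+_) (∑-concatMap xs))

  ∏-concatMap : ∀ xs → ∏ (concatMap h xs) f ≡ ∏[ x ∈ xs ] ∏ (h x) f
  ∏-concatMap []       = refl
  ∏-concatMap (x ∷ xs) = trans (∏-++ f (h x) (concatMap h xs)) (cong (∏ (h x) f ℕ.*_) (∏-concatMap xs))

∏-allFin-suc : ∀ n (f : Fin (suc n) → ℕ) → ∏ (allFin (suc n)) f ≡ f zero ℕ.* ∏ (allFin n) (f ∘ suc)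
∏-allFin-suc n f = cong (f zero ℕ.*_) (trans (cong (λ is → ∏ is f) (sym (Listₚ.map-tabulate id suc))) (∏-map f suc (allFin n)))

length-filter : {P : Pred A _} (P? : Decidable P) → ∀ xs → length (filter P? xs) ≡ ∑ xs (𝟙 ∘ P?)
length-filter P? []       = refl
length-filter P? (x ∷ xs) with P? x
... | yes _ = cong suc (length-filter P? xs)
... | no _  = length-filter P? xs

𝟙-all? : {P : Pred A _} (P? : Decidable P) → ∀ xs → 𝟙 (all? P? xs) ≡ ∏ xs (𝟙 ∘ P?)
𝟙-all? P? []       = refl
𝟙-all? P? (x ∷ xs) = trans (𝟙-×-dec (P? x) (all? P? xs)) (cong (𝟙 (P? x) ℕ.*_) (𝟙-all? P? xs))

module _ (_≟_ : DecidableEquality A) where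

  ∑-≢-All : ∀ {a} (f : A → ℕ) {xs} → All (a ≢_) xs →
            ∑[ x ∈ xs ] (𝟙 (¬? (a ≟ x)) ℕ.* f x) ≡ ∑ xs f
  ∑-≢-All f []              = refl
  ∑-≢-All {a} f (a≢x ∷ a≢xs) =
    cong₂ ℕ._+_ (trans (cong (ℕ._* _) (𝟙-yes (¬? (a ≟ _)) a≢x)) (ℕₚ.*-identityˡ _)) (∑-≢-All f a≢xs)

  ∑-≢ : ∀ {a} (f : A → ℕ) {xs} → Unique xs → a ∈ xs →
        ∑[ x ∈ xs ] (𝟙 (¬? (a ≟ x)) ℕ.* f x) ℕ.+ f a ≡ ∑ xs f
  ∑-≢ {a} f {.a ∷ xs} (a∉xs ∷ _) (here refl) = begin
    𝟙 (¬? (a ≟ a)) ℕ.* f a ℕ.+ S ℕ.+ f a ≡⟨ cong (λ z → z ℕ.* f a ℕ.+ S ℕ.+ f a) (𝟙-no (¬? (a ≟ a)) (λ a≢a → a≢a refl)) ⟩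
    S ℕ.+ f a                            ≡⟨ ℕₚ.+-comm S (f a) ⟩
    f a ℕ.+ S                            ≡⟨ cong (f a ℕ.+_) (∑-≢-All f a∉xs) ⟩
    f a ℕ.+ ∑ xs f                       ∎
    where S = ∑[ x ∈ xs ] (𝟙 (¬? (a ≟ x)) ℕ.* f x)
  ∑-≢ {a} f {y ∷ xs} (y∉xs ∷ xs-unique) (there a∈xs) = begin
    𝟙 (¬? (a ≟ y)) ℕ.* f y ℕ.+ S ℕ.+ f a ≡⟨ cong (λ z → z ℕ.* f y ℕ.+ S ℕ.+ f a) (𝟙-yes (¬? (a ≟ y)) (≢-sym (All.lookup y∉xs a∈xs))) ⟩
    f y ℕ.+ 0 ℕ.+ S ℕ.+ f a              ≡⟨ cong (λ z → z ℕ.+ S ℕ.+ f a) (ℕₚ.+-identityʳ (f y)) ⟩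
    f y ℕ.+ S ℕ.+ f a                    ≡⟨ ℕₚ.+-assoc (f y) S (f a) ⟩
    f y ℕ.+ (S ℕ.+ f a)                  ≡⟨ cong (f y ℕ.+_) (∑-≢ f xs-unique a∈xs) ⟩
    f y ℕ.+ ∑ xs f                       ∎
    where S = ∑[ x ∈ xs ] (𝟙 (¬? (a ≟ x)) ℕ.* f x)

module _ (xs : List A) where

  ∑-allVecs-suc : ∀ N (w : Vec A (suc N) → ℕ) →
                  ∑ (allVecs (suc N) xs) w ≡ ∑[ x ∈ xs ] ∑ (allVecs N xs) (w ∘ (x ∷_))
  ∑-allVecs-suc N w = trans (∑-concatMap w (λ x → map (x ∷_) (allVecs N xs)) xs)
                            (∑-cong (λ x → ∑-map w (x ∷_) (allVecs N xs)) xs)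

  ∑-allVecs-++ : ∀ a b (w : Vec A (a ℕ.+ b) → ℕ) (u : Vec A a → ℕ) (v : Vec A b → ℕ) →
                 (∀ s t → w (s Vec.++ t) ≡ u s ℕ.* v t) →
                 ∑ (allVecs (a ℕ.+ b) xs) w ≡ ∑ (allVecs a xs) u ℕ.* ∑ (allVecs b xs) v
  ∑-allVecs-++ zero b w u v w≡ = begin
    ∑ (allVecs b xs) w                    ≡⟨ ∑-cong (w≡ []) (allVecs b xs) ⟩
    ∑[ t ∈ allVecs b xs ] (u [] ℕ.* v t)  ≡⟨ ∑-*ˡ v (u []) (allVecs b xs) ⟩
    u [] ℕ.* ∑ (allVecs b xs) v           ≡⟨ cong (ℕ._* _) (ℕₚ.+-identityʳ (u [])) ⟨
    (u [] ℕ.+ 0) ℕ.* ∑ (allVecs b xs) v   ∎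
  ∑-allVecs-++ (suc a) b w u v w≡ = begin
    ∑ (allVecs (suc a ℕ.+ b) xs) w
      ≡⟨ ∑-allVecs-suc (a ℕ.+ b) w ⟩
    ∑[ x ∈ xs ] ∑ (allVecs (a ℕ.+ b) xs) (w ∘ (x ∷_))
      ≡⟨ ∑-cong (λ x → ∑-allVecs-++ a b (w ∘ (x ∷_)) (u ∘ (x ∷_)) v (λ s → w≡ (x ∷ s))) xs ⟩
    ∑[ x ∈ xs ] (∑ (allVecs a xs) (u ∘ (x ∷_)) ℕ.* ∑ (allVecs b xs) v)
      ≡⟨ ∑-*ʳ _ _ xs ⟩
    ∑[ x ∈ xs ] ∑ (allVecs a xs) (u ∘ (x ∷_)) ℕ.* ∑ (allVecs b xs) v
      ≡⟨ cong (ℕ._* _) (∑-allVecs-suc a u) ⟨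
    ∑ (allVecs (suc a) xs) u ℕ.* ∑ (allVecs b xs) v
      ∎

  ∑-allVecs-blocks : ∀ n d (W : (Fin d → A) → ℕ) → (∀ {g h} → (∀ j → g j ≡ h j) → W g ≡ W h) →
                     ∑[ r ∈ allVecs (n ℕ.* d) xs ] ∏[ i ∈ allFin n ] W (λ j → lookup r (combine i j))
                       ≡ ∑ (allVecs d xs) (W ∘ lookup) ℕ.^ n
  ∑-allVecs-blocks zero    d W W-cong = refl
  ∑-allVecs-blocks (suc n) d W W-cong = begin
    ∑[ r ∈ allVecs (d ℕ.+ n ℕ.* d) xs ] ∏[ i ∈ allFin (suc n) ] W (block r i)
      ≡⟨ ∑-allVecs-++ d (n ℕ.* d) _ (W ∘ lookup) (λ t → ∏[ i ∈ allFin n ] W (block t i)) split ⟩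
    ∑ (allVecs d xs) (W ∘ lookup) ℕ.* ∑[ t ∈ allVecs (n ℕ.* d) xs ] ∏[ i ∈ allFin n ] W (block t i)
      ≡⟨ cong (∑ (allVecs d xs) (W ∘ lookup) ℕ.*_) (∑-allVecs-blocks n d W W-cong) ⟩
    ∑ (allVecs d xs) (W ∘ lookup) ℕ.^ suc n
      ∎
    where
    block : ∀ {n} → Vec A (n ℕ.* d) → Fin n → Fin d → A
    block r i j = lookup r (combine i j)

    split : ∀ s t → ∏[ i ∈ allFin (suc n) ] W (block (s Vec.++ t) i)
                      ≡ W (lookup s) ℕ.* ∏[ i ∈ allFin n ] W (block t i)
    split s t = trans (∏-allFin-suc n (λ i → W (block (s Vec.++ t) i)))
      (cong₂ ℕ._*_ (W-cong (Vecₚ.lookup-++ˡ s t))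
                   (∏-cong (λ i → W-cong (λ j → Vecₚ.lookup-++ʳ s t (combine i j))) (allFin n)))

m+n≡o⇒m≡o-n : ∀ {m n o} → m ℕ.+ n ≡ o → + m ≡ + o - + n
m+n≡o⇒m≡o-n {m} {n} refl = begin
  + m                 ≡⟨ m≡m+n-n (+ m) (+ n) ⟩
  + m ℤ.+ + n - + n   ≡⟨ cong (_- + n) (ℤₚ.pos-+ m n) ⟨
  + (m ℕ.+ n) - + n   ∎
  where
  m≡m+n-n : ∀ i j → i ≡ i ℤ.+ j - j
  m≡m+n-n = solve-∀

pos-^ : ∀ m n → + (m ℕ.^ n) ≡ (+ m) ^ n
pos-^ m zero    = refl
pos-^ m (suc n) = trans (ℤₚ.pos-* m (m ℕ.^ n)) (cong (+ m *_) (pos-^ m n))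

pos-m*n/m≡n : ∀ m n .{{_ : ℕ.NonZero m}} → (+ m * + n) / + m ≡ + n
pos-m*n/m≡n m n = begin
  (+ m * + n) / + m  ≡⟨ cong (_/ + m) (ℤₚ.pos-* m n) ⟨
  + (m ℕ.* n) / + m  ≡⟨ div-pos-is-/ℕ (+ (m ℕ.* n)) m ⟩
  + (m ℕ.* n ℕ./ m)  ≡⟨ cong (λ z → + (z ℕ./ m)) (ℕₚ.*-comm m n) ⟩
  + (n ℕ.* m ℕ./ m)  ≡⟨ cong +_ (m*n/n≡m n m) ⟩
  + n                ∎

-- Walks in a complete graph

previous : ∀ {d} → A → (Fin d → A) → Fin d → A
previous a g zero    = a
previous a g (suc j) = g (inject₁ j)

module _ (w : A → A → ℕ) where

  pathWeight : ∀ d → A → A → (Fin d → A) → ℕ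
  pathWeight zero    a b g = w a b
  pathWeight (suc d) a b g = w a (g zero) ℕ.* pathWeight d (g zero) b (g ∘ suc)

  pathWeight-cong : ∀ d a b {g h} → (∀ j → g j ≡ h j) → pathWeight d a b g ≡ pathWeight d a b h
  pathWeight-cong zero    a b g≗h = refl
  pathWeight-cong (suc d) a b {g} {h} g≗h rewrite g≗h zero =
    cong (w a (h zero) ℕ.*_) (pathWeight-cong d (h zero) b (g≗h ∘ suc))

  pathWeight-edges : ∀ d a b (g : Fin (suc d) → A) →
                     ∏[ j ∈ allFin (suc d) ] w (previous a g j) (g j) ℕ.* w (g (fromℕ d)) b
                       ≡ pathWeight (suc d) a b g
  pathWeight-edges zero    a b g = cong (ℕ._* w (g zero) b) (ℕₚ.*-identityʳ (w a (g zero)))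
  pathWeight-edges (suc d) a b g = begin
    ∏[ j ∈ allFin (suc (suc d)) ] w (previous a g j) (g j) ℕ.* last
      ≡⟨ cong (ℕ._* last) (∏-allFin-suc (suc d) (λ j → w (previous a g j) (g j))) ⟩
    w a (g zero) ℕ.* ∏[ j ∈ allFin (suc d) ] w (previous a g (suc j)) (g (suc j)) ℕ.* last
      ≡⟨ ℕₚ.*-assoc (w a (g zero)) _ last ⟩
    w a (g zero) ℕ.* (∏[ j ∈ allFin (suc d) ] w (previous a g (suc j)) (g (suc j)) ℕ.* last)
      ≡⟨ cong (λ p → w a (g zero) ℕ.* (p ℕ.* last)) (∏-cong shift (allFin (suc d))) ⟩
    w a (g zero) ℕ.* (∏[ j ∈ allFin (suc d) ] w (previous (g zero) (g ∘ suc) j) (g (suc j)) ℕ.* last)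
      ≡⟨ cong (w a (g zero) ℕ.*_) (pathWeight-edges d (g zero) b (g ∘ suc)) ⟩
    pathWeight (suc (suc d)) a b g
      ∎
    where
    last = w (g (fromℕ (suc d))) b
    shift : ∀ j → w (previous a g (suc j)) (g (suc j)) ≡ w (previous (g zero) (g ∘ suc) j) (g (suc j))
    shift zero    = refl
    shift (suc j) = refl

module CompleteGraph (_≟_ : DecidableEquality A) (xs : List A)
                     (xs-unique : Unique xs) (∈-xs : ∀ x → x ∈ xs) where

  adj : A → A → ℕ
  adj a b = 𝟙 (¬? (a ≟ b))

  adj-sym : ∀ a b → adj a b ≡ adj b a
  adj-sym a b = 𝟙-⇔ (¬? (a ≟ b)) (¬? (b ≟ a)) (λ a≢b → a≢b ∘ sym) (λ b≢a → b≢a ∘ sym)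

  adj-≢ : ∀ {a b} → a ≢ b → adj a b ≡ 1
  adj-≢ {a} {b} = 𝟙-yes (¬? (a ≟ b))

  adj-*-cong : ∀ a b {x y} → (a ≢ b → x ≡ y) → adj a b ℕ.* x ≡ adj a b ℕ.* y
  adj-*-cong a b x≡y with a ≟ b
  ... | yes _   = refl
  ... | no a≢b  = cong (1 ℕ.*_) (x≡y a≢b)

  ∑-adj : ∀ a (f : A → ℕ) → ∑[ x ∈ xs ] (adj a x ℕ.* f x) ℕ.+ f a ≡ ∑ xs f
  ∑-adj a f = ∑-≢ _≟_ f xs-unique (∈-xs a)

  ∑-adj-+1 : ∀ a → ∑[ x ∈ xs ] adj a x ℕ.+ 1 ≡ length xs
  ∑-adj-+1 a = begin
    ∑[ x ∈ xs ] adj a x ℕ.+ 1          ≡⟨ cong (ℕ._+ 1) (∑-cong (λ x → ℕₚ.*-identityʳ (adj a x)) xs) ⟨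
    ∑[ x ∈ xs ] (adj a x ℕ.* 1) ℕ.+ 1  ≡⟨ ∑-adj a (λ _ → 1) ⟩
    ∑[ x ∈ xs ] 1                      ≡⟨ ∑-const 1 xs ⟩
    length xs ℕ.* 1                    ≡⟨ ℕₚ.*-identityʳ (length xs) ⟩
    length xs                          ∎

  ∑-adj-adj-+2 : ∀ {a a′} → a ≢ a′ → ∑[ b ∈ xs ] (adj a b ℕ.* adj a′ b) ℕ.+ 2 ≡ length xs
  ∑-adj-adj-+2 {a} {a′} a≢a′ = begin
    S ℕ.+ 2                     ≡⟨ ℕₚ.+-assoc S 1 1 ⟨
    S ℕ.+ 1 ℕ.+ 1               ≡⟨ cong (λ z → S ℕ.+ z ℕ.+ 1) (adj-≢ (a≢a′ ∘ sym)) ⟨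
    S ℕ.+ adj a′ a ℕ.+ 1        ≡⟨ cong (ℕ._+ 1) (∑-adj a (adj a′)) ⟩
    ∑[ b ∈ xs ] adj a′ b ℕ.+ 1  ≡⟨ ∑-adj-+1 a′ ⟩
    length xs                   ∎
    where S = ∑[ b ∈ xs ] (adj a b ℕ.* adj a′ b)

  -- walks of length d + 1, i.e. with d inner vertices
  walks : ℕ → A → A → ℕ
  walks d a b = ∑ (allVecs d xs) (pathWeight adj d a b ∘ lookup)

  walks-suc : ∀ d a b → walks (suc d) a b ≡ ∑[ x ∈ xs ] (adj a x ℕ.* walks d x b)
  walks-suc d a b = trans (∑-allVecs-suc xs d _)
    (∑-cong (λ x → ∑-*ˡ (pathWeight adj d x b ∘ lookup) (adj a x) (allVecs d xs)) xs)

  walks-suc-+ : ∀ d a b → walks (suc d) a b ℕ.+ walks d a b ≡ ∑[ y ∈ xs ] walks d y b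
  walks-suc-+ d a b = trans (cong (ℕ._+ walks d a b) (walks-suc d a b)) (∑-adj a (λ y → walks d y b))

  q : ℤ
  q = + length xs

  ∑-walks : ∀ d b → + ∑[ y ∈ xs ] walks d y b ≡ (q - 1ℤ) ^ suc d
  ∑-walks zero b = begin
    + ∑[ y ∈ xs ] (adj y b ℕ.+ 0)  ≡⟨ cong +_ (∑-cong (λ y → trans (ℕₚ.+-identityʳ _) (adj-sym y b)) xs) ⟩
    + ∑[ y ∈ xs ] adj b y          ≡⟨ m+n≡o⇒m≡o-n (∑-adj-+1 b) ⟩
    q - 1ℤ                         ≡⟨ ℤₚ.*-identityʳ (q - 1ℤ) ⟨
    (q - 1ℤ) ^ 1                   ∎
  ∑-walks (suc d) b = begin
    + S′                 ≡⟨ m+n≡o⇒m≡o-n S′+S≡qS ⟩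
    + (length xs ℕ.* S) - + S ≡⟨ cong (_- + S) (ℤₚ.pos-* (length xs) S) ⟩
    q * + S - + S        ≡⟨ q*s-s≡[q-1]*s q (+ S) ⟩
    (q - 1ℤ) * + S       ≡⟨ cong ((q - 1ℤ) *_) (∑-walks d b) ⟩
    (q - 1ℤ) ^ suc (suc d) ∎
    where
    S  = ∑[ y ∈ xs ] walks d y b
    S′ = ∑[ y ∈ xs ] walks (suc d) y b
    S′+S≡qS : S′ ℕ.+ S ≡ length xs ℕ.* S
    S′+S≡qS = begin
      S′ ℕ.+ S                                           ≡⟨ ∑-+ xs ⟨
      ∑[ y ∈ xs ] (walks (suc d) y b ℕ.+ walks d y b)  ≡⟨ ∑-cong (λ y → walks-suc-+ d y b) xs ⟩
      ∑[ y ∈ xs ] S                                      ≡⟨ ∑-const S xs ⟩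
      length xs ℕ.* S                                    ∎
    q*s-s≡[q-1]*s : ∀ x y → x * y - y ≡ (x - 1ℤ) * y
    q*s-s≡[q-1]*s = solve-∀

  walks-suc-ℤ : ∀ d a b → + walks (suc d) a b ≡ (q - 1ℤ) ^ suc d - + walks d a b
  walks-suc-ℤ d a b = trans (m+n≡o⇒m≡o-n (walks-suc-+ d a b)) (cong (_- + walks d a b) (∑-walks d b))

  walks-closedForm : ∀ d {a b} → a ≢ b → q * + walks d a b ≡ (q - 1ℤ) ^ suc d - -1ℤ ^ suc d
  walks-closedForm zero {a} {b} a≢b = begin
    q * + (adj a b ℕ.+ 0)    ≡⟨ cong (λ z → q * + z) (trans (ℕₚ.+-identityʳ _) (adj-≢ a≢b)) ⟩
    q * 1ℤ                   ≡⟨ base q ⟩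
    (q - 1ℤ) ^ 1 - -1ℤ ^ 1   ∎
    where
    base : ∀ x → x * 1ℤ ≡ (x - 1ℤ) * 1ℤ - -1ℤ * 1ℤ
    base = solve-∀
  walks-closedForm (suc d) {a} {b} a≢b = begin
    q * + walks (suc d) a b  ≡⟨ cong (q *_) (walks-suc-ℤ d a b) ⟩
    q * (p - + walks d a b)  ≡⟨ distrib q p _ ⟩
    q * p - q * + walks d a b ≡⟨ cong (λ z → q * p - z) (walks-closedForm d a≢b) ⟩
    q * p - (p - s)          ≡⟨ step q p s ⟩
    (q - 1ℤ) * p - -1ℤ * s   ∎
    where
    p = (q - 1ℤ) ^ suc d
    s = -1ℤ ^ suc d
    distrib : ∀ x y z → x * (y - z) ≡ x * y - x * z
    distrib = solve-∀
    step : ∀ x y z → x * y - (y - z) ≡ (x - 1ℤ) * y - -1ℤ * z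
    step = solve-∀

colourVal-injective : ∀ {k} {c c′ : Colour k} → colourVal c ≡ colourVal c′ → c ≡ c′
colourVal-injective {c = s , i} {t , j} eq = cong₂ _,_
  (trans (sym (ℤₚ.sign-◃ s _)) (trans (cong ℤ.sign eq) (ℤₚ.sign-◃ t _)))
  (Finₚ.toℕ-injective (ℕₚ.suc-injective (ℤₚ.abs-cong eq)))

_≟ᶜ_ : ∀ {k} → DecidableEquality (Colour k)
c ≟ᶜ c′ = map′ colourVal-injective (cong colourVal) (colourVal c ℤ.≟ colourVal c′)

allColours-unique : ∀ k → Unique (allColours k)
allColours-unique k = Uniqueₚ.cartesianProduct⁺ {xs = Sign.+ ∷ Sign.- ∷ []} {ys = allFin k} (((λ ()) ∷ []) ∷ [] ∷ []) (Uniqueₚ.allFin⁺ k)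

∈-allColours : ∀ {k} (c : Colour k) → c ∈ allColours k
∈-allColours (Sign.+ , i) = ∈-cartesianProduct⁺ {xs = Sign.+ ∷ Sign.- ∷ []} (here refl) (∈-allFin i)
∈-allColours (Sign.- , i) = ∈-cartesianProduct⁺ {xs = Sign.+ ∷ Sign.- ∷ []} (there (here refl)) (∈-allFin i)

length-allColours : ∀ k → length (allColours k) ≡ 2 ℕ.* k
length-allColours k = begin
  length (allColours k)                                 ≡⟨ Listₚ.length-++ (block Sign.+) ⟩
  length (block Sign.+) ℕ.+ length (block Sign.- ++ [])  ≡⟨ cong (length (block Sign.+) ℕ.+_) (Listₚ.length-++ (block Sign.-)) ⟩
  length (block Sign.+) ℕ.+ (length (block Sign.-) ℕ.+ 0) ≡⟨ cong₂ (λ x y → x ℕ.+ (y ℕ.+ 0)) (length-block Sign.+) (length-block Sign.-) ⟩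
  k ℕ.+ (k ℕ.+ 0)                                       ∎
  where
  block : Sign → List (Colour k)
  block s = map (λ i → s , i) (allFin k)
  length-block : ∀ s → length (block s) ≡ k
  length-block s = trans (Listₚ.length-map _ (allFin k)) (Listₚ.length-tabulate id)

negColour : ∀ {k} → Colour k → Colour k
negColour (s , i) = Sign.opposite s , i

colourVal-negColour : ∀ {k} (c : Colour k) → colourVal (negColour c) ≡ - colourVal c
colourVal-negColour (Sign.+ , i) = refl
colourVal-negColour (Sign.- , i) = refl

negColour-≢ : ∀ {k} (c : Colour k) → c ≢ negColour c
negColour-≢ (Sign.+ , i) ()
negColour-≢ (Sign.- , i) ()

edgeWeight : ∀ {N k} → Vec (Colour k) N → Edge N → ℕ
edgeWeight c (x , y , σ) = 𝟙 (¬? (colourVal (lookup c x) ℤ.≟ signAct σ (colourVal (lookup c y))))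

zeroFreeCount≡∑∏ : ∀ G k → zeroFreeCount G k ≡ ∑[ c ∈ allVecs (nV G) (allColours k) ] ∏ (edges G) (edgeWeight c)
zeroFreeCount≡∑∏ G k = trans (length-filter (proper? G) (allVecs (nV G) (allColours k)))
  (∑-cong (λ c → 𝟙-all? _ (edges G)) (allVecs (nV G) (allColours k)))

-- The book graph

module Book (k′ d′ n : ℕ) where

  k = suc k′
  m = 3 ℕ.+ d′
  d = suc d′

  open CompleteGraph (_≟ᶜ_ {k}) (allColours k) (allColours-unique k) ∈-allColours

  negativeEdge-adj : ∀ a b → 𝟙 (¬? (colourVal a ℤ.≟ - colourVal b)) ≡ adj (negColour a) b
  negativeEdge-adj a b =
    𝟙-⇔ (¬? (colourVal a ℤ.≟ - colourVal b)) (¬? (negColour a ≟ᶜ b)) (λ ne eq → ne (to eq)) (λ ne eq → ne (from eq))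
    where
    to : negColour a ≡ b → colourVal a ≡ - colourVal b
    to refl = sym (trans (cong -_ (colourVal-negColour a)) (ℤₚ.neg-involutive (colourVal a)))
    from : colourVal a ≡ - colourVal b → negColour a ≡ b
    from eq = colourVal-injective (begin
      colourVal (negColour a) ≡⟨ colourVal-negColour a ⟩
      - colourVal a           ≡⟨ cong -_ eq ⟩
      - - colourVal b         ≡⟨ ℤₚ.neg-involutive (colourVal b) ⟩
      colourVal b             ∎)

  row : Fin n → Vec (Colour k) (n ℕ.* d) → Fin d → Colour k
  row i r j = lookup r (combine i j)

  page-weight : ∀ i a b r → ∏ (pageEdges m n i) (edgeWeight (a ∷ b ∷ r)) ≡ pathWeight adj d a b (row i r)
  page-weight i a b r = begin
    ∏ (pageEdges m n i) ew
      ≡⟨ ∏-++ ew (map step (allFin d)) (lastEdge m n d (bx m n i)) ⟩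
    ∏ (map step (allFin d)) ew ℕ.* (adj (g (fromℕ d′)) b ℕ.* 1)
      ≡⟨ cong₂ ℕ._*_ (trans (∏-map ew step (allFin d)) (∏-cong step-weight (allFin d))) (ℕₚ.*-identityʳ _) ⟩
    ∏[ j ∈ allFin d ] adj (previous a g j) (g j) ℕ.* adj (g (fromℕ d′)) b
      ≡⟨ pathWeight-edges adj d′ a b g ⟩
    pathWeight adj d a b g
      ∎
    where
    ew = edgeWeight (a ∷ b ∷ r)
    g = row i r
    step : Fin d → Edge (bookN m n)
    step j = prev m n i j , bx m n i j , Sign.+
    step-weight : ∀ j → ew (step j) ≡ adj (previous a g j) (g j)
    step-weight zero    = refl
    step-weight (suc j) = refl

  book-weight : ∀ a b r → ∏ (edges (bookSigned m n)) (edgeWeight (a ∷ b ∷ r))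
                  ≡ adj a b ℕ.* (adj (negColour a) b ℕ.* ∏[ i ∈ allFin n ] pathWeight adj d a b (row i r))
  book-weight a b r = cong₂ (λ x y → adj a b ℕ.* (x ℕ.* y)) (negativeEdge-adj a b)
    (trans (∏-concatMap (edgeWeight (a ∷ b ∷ r)) (pageEdges m n) (allFin n))
           (∏-cong (λ i → page-weight i a b r) (allFin n)))

  ∑-book-weight : ∀ a b → ∑[ r ∈ allVecs (n ℕ.* d) (allColours k) ] ∏ (edges (bookSigned m n)) (edgeWeight (a ∷ b ∷ r))
                            ≡ adj a b ℕ.* (adj (negColour a) b ℕ.* walks d a b ℕ.^ n)
  ∑-book-weight a b = begin
    ∑[ r ∈ rs ] ∏ (edges (bookSigned m n)) (edgeWeight (a ∷ b ∷ r))
      ≡⟨ ∑-cong (book-weight a b) rs ⟩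
    ∑[ r ∈ rs ] (adj a b ℕ.* (adj (negColour a) b ℕ.* pages r))
      ≡⟨ ∑-*ˡ _ (adj a b) rs ⟩
    adj a b ℕ.* ∑[ r ∈ rs ] (adj (negColour a) b ℕ.* pages r)
      ≡⟨ cong (adj a b ℕ.*_) (∑-*ˡ pages (adj (negColour a) b) rs) ⟩
    adj a b ℕ.* (adj (negColour a) b ℕ.* ∑ rs pages)
      ≡⟨ cong (λ z → adj a b ℕ.* (adj (negColour a) b ℕ.* z))
              (∑-allVecs-blocks (allColours k) n d (pathWeight adj d a b) (pathWeight-cong adj d a b)) ⟩
    adj a b ℕ.* (adj (negColour a) b ℕ.* walks d a b ℕ.^ n)
      ∎
    where
    rs = allVecs (n ℕ.* d) (allColours k)
    pages : Vec (Colour k) (n ℕ.* d) → ℕ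
    pages r = ∏[ i ∈ allFin n ] pathWeight adj d a b (row i r)

  gamma≡walks : ∀ {a b} → a ≢ b → gamma m k′ ≡ + walks d a b
  gamma≡walks {a} {b} a≢b = begin
    gamma m k′                          ≡⟨ cong (_/ lam k′) numerator ⟩
    (lam k′ * + walks d a b) / lam k′   ≡⟨ pos-m*n/m≡n (2 ℕ.* k) (walks d a b) ⟩
    + walks d a b                       ∎
    where
    numerator : (lam k′ - 1ℤ) ^ suc d - -1ℤ ^ suc d ≡ lam k′ * + walks d a b
    numerator = subst (λ x → (x - 1ℤ) ^ suc d - -1ℤ ^ suc d ≡ x * + walks d a b)
                      (cong +_ (length-allColours k)) (sym (walks-closedForm d a≢b))

  -- by gamma≡walks, any pair of distinct colours would do
  γ : ℕ
  γ = walks d (Sign.+ , zero) (Sign.- , zero)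

  gamma≡γ : gamma m k′ ≡ + γ
  gamma≡γ = gamma≡walks (negColour-≢ (Sign.+ , zero))

  walks≡γ : ∀ {a b} → a ≢ b → walks d a b ≡ γ
  walks≡γ a≢b = ℤₚ.+-injective (trans (sym (gamma≡walks a≢b)) gamma≡γ)

  adj-*-walks≡γ : ∀ a b x → adj a b ℕ.* (x ℕ.* walks d a b ℕ.^ n) ≡ adj a b ℕ.* x ℕ.* γ ℕ.^ n
  adj-*-walks≡γ a b x = begin
    adj a b ℕ.* (x ℕ.* walks d a b ℕ.^ n) ≡⟨ adj-*-cong a b (λ a≢b → cong (λ w → x ℕ.* w ℕ.^ n) (walks≡γ a≢b)) ⟩
    adj a b ℕ.* (x ℕ.* γ ℕ.^ n)           ≡⟨ ℕₚ.*-assoc (adj a b) x (γ ℕ.^ n) ⟨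
    adj a b ℕ.* x ℕ.* γ ℕ.^ n             ∎

  -- Zero-freeness enters here: a ≢ negColour a.
  ∑-adj-adj-negColour : ∀ a → ∑[ b ∈ allColours k ] (adj a b ℕ.* adj (negColour a) b) ≡ 2 ℕ.* k′
  ∑-adj-adj-negColour a = ℕₚ.+-cancelʳ-≡ 2 _ _ (begin
    ∑[ b ∈ allColours k ] (adj a b ℕ.* adj (negColour a) b) ℕ.+ 2 ≡⟨ ∑-adj-adj-+2 (negColour-≢ a) ⟩
    length (allColours k)                                        ≡⟨ length-allColours k ⟩
    2 ℕ.* k                                                      ≡⟨ ℕₚ.*-suc 2 k′ ⟩
    2 ℕ.+ 2 ℕ.* k′                                               ≡⟨ ℕₚ.+-comm 2 _ ⟩
    2 ℕ.* k′ ℕ.+ 2                                               ∎)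

  zeroFreeCount-book : zeroFreeCount (bookSigned m n) k ≡ 2 ℕ.* k ℕ.* (2 ℕ.* k′ ℕ.* γ ℕ.^ n)
  zeroFreeCount-book = begin
    zeroFreeCount (bookSigned m n) k
      ≡⟨ zeroFreeCount≡∑∏ (bookSigned m n) k ⟩
    ∑[ c ∈ allVecs (2 ℕ.+ n ℕ.* d) cs ] ∏ (edges (bookSigned m n)) (edgeWeight c)
      ≡⟨ ∑-allVecs-suc cs (suc (n ℕ.* d)) weight ⟩
    ∑[ a ∈ cs ] ∑[ v ∈ allVecs (suc (n ℕ.* d)) cs ] ∏ (edges (bookSigned m n)) (edgeWeight (a ∷ v))
      ≡⟨ ∑-cong (λ a → ∑-allVecs-suc cs (n ℕ.* d) (weight ∘ (a ∷_))) cs ⟩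
    ∑[ a ∈ cs ] ∑[ b ∈ cs ] ∑[ r ∈ allVecs (n ℕ.* d) cs ] ∏ (edges (bookSigned m n)) (edgeWeight (a ∷ b ∷ r))
      ≡⟨ ∑-cong (λ a → ∑-cong (λ b → trans (∑-book-weight a b) (adj-*-walks≡γ a b (adj (negColour a) b))) cs) cs ⟩
    ∑[ a ∈ cs ] ∑[ b ∈ cs ] (adj a b ℕ.* adj (negColour a) b ℕ.* γ ℕ.^ n)
      ≡⟨ ∑-cong (λ a → trans (∑-*ʳ (λ b → adj a b ℕ.* adj (negColour a) b) (γ ℕ.^ n) cs) (cong (ℕ._* γ ℕ.^ n) (∑-adj-adj-negColour a))) cs ⟩
    ∑[ a ∈ cs ] (2 ℕ.* k′ ℕ.* γ ℕ.^ n)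
      ≡⟨ ∑-const (2 ℕ.* k′ ℕ.* γ ℕ.^ n) cs ⟩
    length cs ℕ.* (2 ℕ.* k′ ℕ.* γ ℕ.^ n)
      ≡⟨ cong (ℕ._* (2 ℕ.* k′ ℕ.* γ ℕ.^ n)) (length-allColours k) ⟩
    2 ℕ.* k ℕ.* (2 ℕ.* k′ ℕ.* γ ℕ.^ n)
      ∎
    where
    cs = allColours k
    weight : Vec (Colour k) (bookN m n) → ℕ
    weight c = ∏ (edges (bookSigned m n)) (edgeWeight c)

proposition4p4 : (m n : ℕ) → 3 ≤ m → 2 ≤ n → (k' : ℕ) →
    + zeroFreeCount (bookSigned m n) (suc k') ≡ lam k' * (lam k' - + 2) * (gamma m k' ^ n)
proposition4p4 (suc (suc (suc d′))) n (s≤s (s≤s (s≤s _))) _ k′ = begin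
  + zeroFreeCount (bookSigned m n) k                  ≡⟨ cong +_ zeroFreeCount-book ⟩
  + (2 ℕ.* k ℕ.* (2 ℕ.* k′ ℕ.* γ ℕ.^ n))              ≡⟨ ℤₚ.pos-* (2 ℕ.* k) (2 ℕ.* k′ ℕ.* γ ℕ.^ n) ⟩
  lam k′ * + (2 ℕ.* k′ ℕ.* γ ℕ.^ n)                   ≡⟨ cong (lam k′ *_) (ℤₚ.pos-* (2 ℕ.* k′) (γ ℕ.^ n)) ⟩
  lam k′ * (+ (2 ℕ.* k′) * + (γ ℕ.^ n))               ≡⟨ cong₂ (λ x y → lam k′ * (x * y)) 2k′≡lam-2 (pos-^ γ n) ⟩
  lam k′ * ((lam k′ - + 2) * (+ γ) ^ n)               ≡⟨ cong (λ x → lam k′ * ((lam k′ - + 2) * x ^ n)) gamma≡γ ⟨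
  lam k′ * ((lam k′ - + 2) * gamma m k′ ^ n)          ≡⟨ ℤₚ.*-assoc (lam k′) (lam k′ - + 2) (gamma m k′ ^ n) ⟨
  lam k′ * (lam k′ - + 2) * gamma m k′ ^ n            ∎
  where
  open Book k′ d′ n
  2k′≡lam-2 : + (2 ℕ.* k′) ≡ lam k′ - + 2
  2k′≡lam-2 = m+n≡o⇒m≡o-n (trans (ℕₚ.+-comm (2 ℕ.* k′) 2) (sym (ℕₚ.*-suc 2 k′)))
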